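{- Let $N$ be a sufficiently large integer, $d:=\lceil\sqrt{\log N}\rceil$, $X:=d^{1000d}$ and $k:=d^4$. Let $\mathbf{n}_1,\dots,\mathbf{n}_k$ be i.i.d. random variables uniformly distributed in $\{1,\dots,X\}$. Then the probability that at least $d$ of these $\mathbf{n}_i$ are prime numbers not dividing $N$ is $1+O(1/N)$.
   Context: The implied constant is absolute; $\log$ is the natural logarithm. -}

module Defs where

open import Data.Nat using (ℕ; zero; suc; _+_; _*_; _∸_; _^_; _≤_; _<_; _!)
open import Data.Nat.Divisibility using (_∣_; _∣?_)
open import Data.Nat.Primality using (Prime; prime?)
open import Data.List using (List; []; _∷_; length; filter; map; concatMap)
open import Data.Product using (∃; _×_)
open import Relation.Nullary using (¬_; Dec)
open import Relation.Nullary.Decidable using (_×-dec_; ¬?)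

-- expPartial m K = K! * Σ_{j=0}^{K} m^j / j!   (a natural number)
expPartial : ℕ → ℕ → ℕ
expPartial m zero    = 1
expPartial m (suc K) = suc K * expPartial m K + m ^ suc K

-- ExpGt m N  :⇔  e^m > N.
-- The partial sums Σ_{j≤K} m^j/j! increase to e^m, so e^m > N iff some
-- partial sum exceeds N, i.e. N * K! < expPartial m K for some K.
ExpGt : ℕ → ℕ → Set
ExpGt m N = ∃ λ K → N * (K !) < expPartial m K

-- IsD N d  :⇔  d = ⌈√(log N)⌉  (natural log), for N ≥ 2:
--   (d-1)^2 < log N ≤ d^2,  i.e.  e^{(d-1)^2} < N ≤ e^{d^2}.
-- Since e^m is irrational for m ≥ 1 (and e^0 = 1 < N), "N ≤ e^{d^2}" is
-- equivalent to ExpGt (d^2) N, and "e^{(d-1)^2} < N" to ¬ ExpGt ((d-1)^2) N.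
IsD : ℕ → ℕ → Set
IsD N d = ExpGt (d * d) N × ¬ ExpGt ((d ∸ 1) * (d ∸ 1)) N

range1 : ℕ → List ℕ
range1 zero    = []
range1 (suc X) = range1 X Data.List.++ (suc X ∷ [])

tuples : ℕ → List ℕ → List (List ℕ)
tuples zero    xs = [] ∷ []
tuples (suc k) xs = concatMap (λ x → map (x ∷_) (tuples k xs)) xs

good? : (N n : ℕ) → Dec (Prime n × ¬ (n ∣ N))
good? N n = prime? n ×-dec ¬? (n ∣? N)

numGood : ℕ → List ℕ → ℕ
numGood N t = length (filter (good? N) t)

badCount : (N d X k : ℕ) → ℕ
badCount N d X k = length (filter (λ t → numGood N t Data.Nat.<? d) (tuples k (range1 X)))

-- Call n ∈ {1, …, X} good if it is a prime not dividing N, and pick b ≈ log₂ d with d ≤ 2^b, so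
-- that X ≤ 2^B for B = 1000 d b.  Since lcm(1, …, 2n+1) ≥ 4^n and lcm(1, …, X) ≤ X^π(X), we get
-- 2^X ≤ 4 X^π(X), i.e. π(X) ≥ (X − 2)/B; and N ≤ e^(d²) < 2^(4d²+1) has at most 4d² prime factors.
-- Hence a fraction at least 1/Q of {1, …, X} is good, Q = 2B.  Splitting k-tuples by their first
-- entry, at most (k+1)^d X^d Y^(k−d) of them have fewer than d good entries, where Y ≤ (1 − 1/Q) X
-- counts the bad n; as (1 − 1/Q)^Q ≤ 1/2 this is at most X^k (k+1)^d 2^(−(k−d)/Q) ≤ X^k / N
-- for k = d⁴.

module Submission where

open import Defs
open import Data.Nat
open import Data.Nat.Properties
open import Data.Nat.Induction using (<-wellFounded)
open import Data.Nat.Divisibility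
open import Data.Nat.Primality using (Prime; prime?; prime⇒nonTrivial; euclidsLemma)
open import Data.Nat.Primality.Factorisation using (factorise)
open import Data.Nat.ListAction using (product)
open import Data.Nat.ListAction.Properties using (product-++)
open import Data.Nat.Tactic.RingSolver using (solve-∀)
open import Data.Bool using (true; false)
open import Data.Empty using (⊥-elim)
open import Data.List using (List; []; _∷_; length; filter; _++_; map; concatMap)
open import Data.List.Properties using (filter-++; filter-accept; filter-reject; length-++; length-map; length-filter; ++-identityʳ)
open import Data.List.Relation.Unary.All using (_∷_)
open import Data.Product using (_,_; _×_; ∃; ∃₂)
open import Data.Sum using (_⊎_; inj₁; inj₂)
open import Data.Unit using (tt)
open import Induction.WellFounded using (Acc; acc)
open import Level using (0ℓ)
open import Relation.Nullary using (¬_; yes; no; does)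
open import Relation.Nullary.Decidable using (_×-dec_)
open import Relation.Nullary.Negation using (contradiction)
open import Relation.Unary using (Pred; Decidable)
open import Relation.Unary.Properties using (∁?)
open import Relation.Binary.PropositionalEquality
open import Algebra.Properties.CommutativeSemigroup *-commutativeSemigroup using (x∙yz≈y∙xz)

^-distribʳ-* : ∀ m n o → (m * n) ^ o ≡ m ^ o * n ^ o
^-distribʳ-* m n zero    = refl
^-distribʳ-* m n (suc o) = begin
  m * n * (m * n) ^ o     ≡⟨ cong (m * n *_) (^-distribʳ-* m n o) ⟩
  m * n * (m ^ o * n ^ o) ≡⟨ interchange m n (m ^ o) (n ^ o) ⟩
  m * m ^ o * (n * n ^ o) ∎
  where
  open ≡-Reasoning
  interchange : ∀ a b c d → a * b * (c * d) ≡ a * c * (b * d)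
  interchange = solve-∀

-- (n+1)^r − n^r ≤ r (n+1)^(r−1), multiplied by n+1 so that no subtraction occurs.
suc-^-mean-value : ∀ n r → suc n * suc n ^ r ≤ suc n * n ^ r + r * suc n ^ r
suc-^-mean-value n zero    = m≤m+n (suc n * 1) 0
suc-^-mean-value n (suc r) = begin
  a * (a * a ^ r)               ≤⟨ *-monoʳ-≤ a (suc-^-mean-value n r) ⟩
  a * (a * n ^ r + r * a ^ r)   ≡⟨ expand n (n ^ r) r (a ^ r) ⟩
  a * (n * n ^ r) + a * n ^ r + r * (a * a ^ r)
                                ≤⟨ +-monoˡ-≤ (r * (a * a ^ r)) (+-monoʳ-≤ (a * (n * n ^ r)) (*-monoʳ-≤ a (^-monoˡ-≤ r (n≤1+n n)))) ⟩
  a * (n * n ^ r) + a * a ^ r + r * (a * a ^ r)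
                                ≡⟨ +-assoc (a * (n * n ^ r)) _ _ ⟩
  a * (n * n ^ r) + suc r * (a * a ^ r) ∎
  where
  open ≤-Reasoning
  a = suc n
  expand : ∀ n x r y → suc n * (suc n * x + r * y) ≡ suc n * (n * x) + suc n * x + r * (suc n * y)
  expand = solve-∀

[1+n]^r≤2*n^r : ∀ n r → 2 * r ≤ suc n → suc n ^ r ≤ 2 * n ^ r
[1+n]^r≤2*n^r n r 2r≤a = *-cancelˡ-≤ a (+-cancelʳ-≤ (a * a ^ r) (a * a ^ r) (a * (2 * n ^ r)) (begin
  a * a ^ r + a * a ^ r               ≡⟨ double (a * a ^ r) ⟩
  2 * (a * a ^ r)                     ≤⟨ *-monoʳ-≤ 2 (suc-^-mean-value n r) ⟩
  2 * (a * n ^ r + r * a ^ r)         ≡⟨ distribute a (n ^ r) r (a ^ r) ⟩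
  a * (2 * n ^ r) + 2 * r * a ^ r     ≤⟨ +-monoʳ-≤ (a * (2 * n ^ r)) (*-monoˡ-≤ (a ^ r) 2r≤a) ⟩
  a * (2 * n ^ r) + a * a ^ r         ∎))
  where
  open ≤-Reasoning
  a = suc n
  double : ∀ x → x + x ≡ 2 * x
  double = solve-∀
  distribute : ∀ a x r y → 2 * (a * x + r * y) ≡ a * (2 * x) + 2 * r * y
  distribute = solve-∀

2*⌈n/2⌉≤1+n : ∀ n → 2 * ⌈ n /2⌉ ≤ suc n
2*⌈n/2⌉≤1+n n = begin
  2 * h                     ≡⟨ cong (h +_) (+-identityʳ h) ⟩
  h + h                     ≤⟨ +-monoʳ-≤ h (⌊n/2⌋≤⌈n/2⌉ (suc n)) ⟩
  h + ⌈ suc n /2⌉           ≡⟨ ⌊n/2⌋+⌈n/2⌉≡n (suc n) ⟩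
  suc n                     ∎
  where
  open ≤-Reasoning
  h = ⌈ n /2⌉

[1+n]^n≤4*n^n : ∀ n → suc n ^ n ≤ 4 * n ^ n
[1+n]^n≤4*n^n n = begin
  suc n ^ n                         ≡⟨ cong (suc n ^_) (sym split) ⟩
  suc n ^ (l + h)                   ≡⟨ ^-distribˡ-+-* (suc n) l h ⟩
  suc n ^ l * suc n ^ h             ≤⟨ *-mono-≤ ([1+n]^r≤2*n^r n l 2l≤1+n) ([1+n]^r≤2*n^r n h (2*⌈n/2⌉≤1+n n)) ⟩
  (2 * n ^ l) * (2 * n ^ h)         ≡⟨ interchange (n ^ l) (n ^ h) ⟩
  4 * (n ^ l * n ^ h)               ≡⟨ cong (4 *_) (sym (^-distribˡ-+-* n l h)) ⟩
  4 * n ^ (l + h)                   ≡⟨ cong (λ e → 4 * n ^ e) split ⟩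
  4 * n ^ n                         ∎
  where
  open ≤-Reasoning
  l = ⌊ n /2⌋
  h = ⌈ n /2⌉
  split = ⌊n/2⌋+⌈n/2⌉≡n n
  2l≤1+n = ≤-trans (*-monoʳ-≤ 2 (⌊n/2⌋≤⌈n/2⌉ n)) (2*⌈n/2⌉≤1+n n)
  interchange : ∀ x y → (2 * x) * (2 * y) ≡ 4 * (x * y)
  interchange = solve-∀

n^n≤4^n*n! : ∀ n → n ^ n ≤ 4 ^ n * n !
n^n≤4^n*n! zero    = ≤-refl
n^n≤4^n*n! (suc n) = begin
  suc n * suc n ^ n             ≤⟨ *-monoʳ-≤ (suc n) ([1+n]^n≤4*n^n n) ⟩
  suc n * (4 * n ^ n)           ≤⟨ *-monoʳ-≤ (suc n) (*-monoʳ-≤ 4 (n^n≤4^n*n! n)) ⟩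
  suc n * (4 * (4 ^ n * n !))   ≡⟨ rearrange (suc n) (4 ^ n) (n !) ⟩
  4 * 4 ^ n * (suc n * n !)     ∎
  where
  open ≤-Reasoning
  rearrange : ∀ a b c → a * (4 * (b * c)) ≡ 4 * b * (a * c)
  rearrange = solve-∀

[j+t]!≤j!*n^t : ∀ j t {n} → j + t ≤ n → (j + t) ! ≤ j ! * n ^ t
[j+t]!≤j!*n^t j zero    _  = ≤-reflexive (trans (cong _! (+-identityʳ j)) (sym (*-identityʳ (j !))))
[j+t]!≤j!*n^t j (suc t) {n} j+t<n = begin
  (j + suc t) !             ≡⟨ cong _! (+-suc j t) ⟩
  suc (j + t) * (j + t) !   ≤⟨ *-mono-≤ (subst (_≤ n) (+-suc j t) j+t<n) ([j+t]!≤j!*n^t j t (≤-trans (+-monoʳ-≤ j (n≤1+n t)) j+t<n)) ⟩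
  n * (j ! * n ^ t)         ≡⟨ x∙yz≈y∙xz n (j !) (n ^ t) ⟩
  j ! * (n * n ^ t)         ∎
  where open ≤-Reasoning

m!*m^t≤[m+t]! : ∀ m t → m ! * m ^ t ≤ (m + t) !
m!*m^t≤[m+t]! m zero    = ≤-reflexive (trans (*-identityʳ (m !)) (cong _! (sym (+-identityʳ m))))
m!*m^t≤[m+t]! m (suc t) = begin
  m ! * (m * m ^ t)         ≡⟨ x∙yz≈y∙xz (m !) m (m ^ t) ⟩
  m * (m ! * m ^ t)         ≤⟨ *-mono-≤ (m≤n⇒m≤1+n (m≤m+n m t)) (m!*m^t≤[m+t]! m t) ⟩
  suc (m + t) * (m + t) !   ≡⟨ cong _! (sym (+-suc m t)) ⟩
  (m + suc t) !             ∎
  where open ≤-Reasoning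

m^j*m!≤m^m*j! : ∀ m j → m ^ j * m ! ≤ m ^ m * j !
m^j*m!≤m^m*j! m j with ≤-total j m
... | inj₁ j≤m = begin
  m ^ j * m !               ≡⟨ cong (λ n → m ^ j * n !) (sym j+t≡m) ⟩
  m ^ j * (j + t) !         ≤⟨ *-monoʳ-≤ (m ^ j) ([j+t]!≤j!*n^t j t (≤-reflexive j+t≡m)) ⟩
  m ^ j * (j ! * m ^ t)     ≡⟨ x∙yz≈y∙xz (m ^ j) (j !) (m ^ t) ⟩
  j ! * (m ^ j * m ^ t)     ≡⟨ cong (j ! *_) (sym (^-distribˡ-+-* m j t)) ⟩
  j ! * m ^ (j + t)         ≡⟨ *-comm (j !) _ ⟩
  m ^ (j + t) * j !         ≡⟨ cong (λ n → m ^ n * j !) j+t≡m ⟩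
  m ^ m * j !               ∎
  where
  open ≤-Reasoning
  t = m ∸ j
  j+t≡m = m+[n∸m]≡n j≤m
... | inj₂ m≤j = begin
  m ^ j * m !               ≡⟨ cong (λ n → m ^ n * m !) (sym m+t≡j) ⟩
  m ^ (m + t) * m !         ≡⟨ cong (_* m !) (^-distribˡ-+-* m m t) ⟩
  m ^ m * m ^ t * m !       ≡⟨ *-assoc (m ^ m) (m ^ t) (m !) ⟩
  m ^ m * (m ^ t * m !)     ≤⟨ *-monoʳ-≤ (m ^ m) (≤-trans (≤-reflexive (*-comm (m ^ t) (m !))) (m!*m^t≤[m+t]! m t)) ⟩
  m ^ m * (m + t) !         ≡⟨ cong (λ n → m ^ m * n !) m+t≡j ⟩
  m ^ m * j !               ∎
  where
  open ≤-Reasoning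
  t = j ∸ m
  m+t≡j = m+[n∸m]≡n m≤j

m^j≤j!*4^m : ∀ m j → m ^ j ≤ j ! * 4 ^ m
m^j≤j!*4^m m j = *-cancelʳ-≤ _ _ (m !) {{m !≢0}} (begin
  m ^ j * m !               ≤⟨ m^j*m!≤m^m*j! m j ⟩
  m ^ m * j !               ≤⟨ *-monoˡ-≤ (j !) (n^n≤4^n*n! m) ⟩
  4 ^ m * m ! * j !         ≡⟨ rearrange (4 ^ m) (m !) (j !) ⟩
  j ! * 4 ^ m * m !         ∎)
  where
  open ≤-Reasoning
  rearrange : ∀ a b c → a * b * c ≡ c * a * b
  rearrange = solve-∀

-- Σ_{j≤K} m^j/j! ≤ (2 − 2^−K) 16^m, cleared of denominators: each term is at most 16^m / 2^j.
expPartial-bound : ∀ m K → 2 ^ K * expPartial m K + K ! * 16 ^ m ≤ 2 ^ suc K * K ! * 16 ^ m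
expPartial-bound m zero    = begin
  1 * 1 + 1 * 16 ^ m        ≤⟨ +-monoˡ-≤ (1 * 16 ^ m) (*-monoʳ-≤ 1 (m^n>0 16 m)) ⟩
  1 * 16 ^ m + 1 * 16 ^ m   ≡⟨ sym (*-distribʳ-+ (16 ^ m) 1 1) ⟩
  2 * 1 * 16 ^ m            ∎
  where open ≤-Reasoning
expPartial-bound m (suc K) = begin
  2 ^ suc K * (suc K * E + m ^ suc K) + suc K * K ! * W
      ≡⟨ expand (2 ^ K) (suc K) E (m ^ suc K) (K !) W ⟩
  2 * suc K * (2 ^ K * E) + 2 ^ suc K * m ^ suc K + suc K * K ! * W
      ≡⟨ cong (λ x → 2 * suc K * (2 ^ K * E) + x + suc K * K ! * W) (sym (^-distribʳ-* 2 m (suc K))) ⟩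
  2 * suc K * (2 ^ K * E) + (2 * m) ^ suc K + suc K * K ! * W
      ≤⟨ +-monoˡ-≤ (suc K * K ! * W) (+-monoʳ-≤ (2 * suc K * (2 ^ K * E)) 2m^[1+K]≤[1+K]!*W) ⟩
  2 * suc K * (2 ^ K * E) + suc K * K ! * W + suc K * K ! * W
      ≡⟨ collect (suc K) (2 ^ K * E) (K !) W ⟩
  2 * suc K * (2 ^ K * E + K ! * W)
      ≤⟨ *-monoʳ-≤ (2 * suc K) (expPartial-bound m K) ⟩
  2 * suc K * (2 ^ suc K * K ! * W)
      ≡⟨ regroup (suc K) (2 ^ suc K) (K !) W ⟩
  2 ^ suc (suc K) * (suc K * K !) * W ∎
  where
  open ≤-Reasoning
  W = 16 ^ m
  E = expPartial m K
  2m^[1+K]≤[1+K]!*W : (2 * m) ^ suc K ≤ suc K ! * W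
  2m^[1+K]≤[1+K]!*W = subst (λ w → (2 * m) ^ suc K ≤ suc K ! * w) (sym (^-*-assoc 4 2 m)) (m^j≤j!*4^m (2 * m) (suc K))
  expand : ∀ p s e x f w → 2 * p * (s * e + x) + s * f * w ≡ 2 * s * (p * e) + 2 * p * x + s * f * w
  expand = solve-∀
  collect : ∀ s x f w → 2 * s * x + s * f * w + s * f * w ≡ 2 * s * (x + f * w)
  collect = solve-∀
  regroup : ∀ s p f w → 2 * s * (p * f * w) ≡ 2 * p * (s * f) * w
  regroup = solve-∀

expGt⇒< : ∀ {m N} → ExpGt m N → N < 2 ^ suc (4 * m)
expGt⇒< {m} {N} (K , N*K!<E) = subst (N <_) (cong (2 *_) (^-*-assoc 2 4 m)) (*-cancelʳ-< (2 ^ K * K !) N (2 * 16 ^ m) (begin-strict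
  N * (2 ^ K * K !)                     ≡⟨ x∙yz≈y∙xz N (2 ^ K) (K !) ⟩
  2 ^ K * (N * K !)                     <⟨ *-monoʳ-< (2 ^ K) {{m^n≢0 2 K}} N*K!<E ⟩
  2 ^ K * expPartial m K                ≤⟨ m≤m+n _ _ ⟩
  2 ^ K * expPartial m K + K ! * 16 ^ m ≤⟨ expPartial-bound m K ⟩
  2 ^ suc K * K ! * 16 ^ m              ≡⟨ rearrange (2 ^ K) (K !) (16 ^ m) ⟩
  2 * 16 ^ m * (2 ^ K * K !)            ∎))
  where
  open ≤-Reasoning
  rearrange : ∀ p f w → 2 * p * f * w ≡ 2 * w * (p * f)
  rearrange = solve-∀

count : {P : Pred ℕ 0ℓ} → Decidable P → ℕ → ℕ
count P? n = length (filter P? (range1 n))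

module _ {P : Pred ℕ 0ℓ} (P? : Decidable P) where

  filter-range1-suc-yes : ∀ n → P (suc n) → filter P? (range1 (suc n)) ≡ filter P? (range1 n) ++ suc n ∷ []
  filter-range1-suc-yes n p = trans (filter-++ P? (range1 n) (suc n ∷ [])) (cong (filter P? (range1 n) ++_) (filter-accept P? p))

  filter-range1-suc-no : ∀ n → ¬ P (suc n) → filter P? (range1 (suc n)) ≡ filter P? (range1 n)
  filter-range1-suc-no n ¬p = trans (filter-++ P? (range1 n) (suc n ∷ []))
    (trans (cong (filter P? (range1 n) ++_) (filter-reject P? ¬p)) (++-identityʳ (filter P? (range1 n))))

  count-suc-yes : ∀ n → P (suc n) → count P? (suc n) ≡ suc (count P? n)
  count-suc-yes n p = trans (cong length (filter-range1-suc-yes n p))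
    (trans (length-++ (filter P? (range1 n))) (+-comm (count P? n) 1))

  count-suc-no : ∀ n → ¬ P (suc n) → count P? (suc n) ≡ count P? n
  count-suc-no n ¬p = cong length (filter-range1-suc-no n ¬p)

  count-mono-≤ : ∀ {m n} → m ≤ n → count P? m ≤ count P? n
  count-mono-≤ {n = zero}  z≤n = ≤-refl
  count-mono-≤ {m} {suc n} m≤1+n with m≤n⇒m<n∨m≡n m≤1+n | P? (suc n)
  ... | inj₂ refl | _     = ≤-refl
  ... | inj₁ m<1+n | yes p = ≤-trans (m≤n⇒m≤1+n (count-mono-≤ (≤-pred m<1+n))) (≤-reflexive (sym (count-suc-yes n p)))
  ... | inj₁ m<1+n | no ¬p = ≤-trans (count-mono-≤ (≤-pred m<1+n)) (≤-reflexive (sym (count-suc-no n ¬p)))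

primeCount : ℕ → ℕ
primeCount = count prime?

prime⇒2≤ : ∀ {p} → Prime p → 2 ≤ p
prime⇒2≤ {p} pr = nonTrivial⇒n>1 p {{prime⇒nonTrivial pr}}

n<2^n : ∀ n → n < 2 ^ n
n<2^n zero    = s≤s z≤n
n<2^n (suc n) = begin-strict
  suc n             <⟨ s≤s (n<2^n n) ⟩
  suc (2 ^ n)       ≤⟨ +-monoˡ-≤ (2 ^ n) (m^n>0 2 n) ⟩
  2 ^ n + 2 ^ n     ≡⟨ cong (2 ^ n +_) (sym (+-identityʳ (2 ^ n))) ⟩
  2 * 2 ^ n         ∎
  where open ≤-Reasoning

logSearch : (fuel p M i : ℕ) → ℕ
logSearch zero    p M i = i
logSearch (suc f) p M i with p ^ suc i ≤? M
... | yes _ = logSearch f p M (suc i)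
... | no _  = i

logSearch-^≤ : ∀ f p M i → p ^ i ≤ M → p ^ logSearch f p M i ≤ M
logSearch-^≤ zero    p M i p^i≤M = p^i≤M
logSearch-^≤ (suc f) p M i p^i≤M with p ^ suc i ≤? M
... | yes p^1+i≤M = logSearch-^≤ f p M (suc i) p^1+i≤M
... | no _        = p^i≤M

logSearch-exhausted⊎< : ∀ f p M i → logSearch f p M i ≡ i + f ⊎ M < p ^ suc (logSearch f p M i)
logSearch-exhausted⊎< zero    p M i = inj₁ (sym (+-identityʳ i))
logSearch-exhausted⊎< (suc f) p M i with p ^ suc i ≤? M
... | no p^1+i≰M = inj₂ (≰⇒> p^1+i≰M)
... | yes _ with logSearch-exhausted⊎< f p M (suc i)
...   | inj₁ eq = inj₁ (trans eq (sym (+-suc i f)))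
...   | inj₂ lt = inj₂ lt

-- ⌊log_p M⌋; the fuel M suffices since p ^ M > M for p ≥ 2.
largestExponent : ℕ → ℕ → ℕ
largestExponent p M = logSearch M p M 0

largestExponent-^≤ : ∀ p {M} → 1 ≤ M → p ^ largestExponent p M ≤ M
largestExponent-^≤ p {M} = logSearch-^≤ M p M 0

largestExponent-maximal : ∀ {p M a} → 2 ≤ p → p ^ a ≤ M → a ≤ largestExponent p M
largestExponent-maximal {p} {M} {a} 2≤p p^a≤M with logSearch-exhausted⊎< M p M 0
... | inj₁ e≡M = ≤-trans (<⇒≤ (<-≤-trans (n<2^n a) (≤-trans (^-monoˡ-≤ a 2≤p) p^a≤M))) (≤-reflexive (sym e≡M))
... | inj₂ M<p^1+e = ≮⇒≥ λ e<a → <⇒≱ M<p^1+e (≤-trans (^-monoʳ-≤ p {{>-nonZero (<-trans (s≤s z≤n) 2≤p)}} e<a) p^a≤M)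

^-monoʳ-∣ : ∀ p {a e} → a ≤ e → p ^ a ∣ p ^ e
^-monoʳ-∣ p {a} {e} a≤e = subst (p ^ a ∣_) p^a*p^[e∸a]≡p^e (m∣m*n (p ^ (e ∸ a)))
  where
  p^a*p^[e∸a]≡p^e : p ^ a * p ^ (e ∸ a) ≡ p ^ e
  p^a*p^[e∸a]≡p^e = trans (sym (^-distribˡ-+-* p a (e ∸ a))) (cong (p ^_) (m+[n∸m]≡n a≤e))

∃prime∣ : ∀ {m} → 2 ≤ m → ∃ λ q → Prime q × q ∣ m
∃prime∣ {m} 2≤m with factorise m {{>-nonZero (<-trans (s≤s z≤n) 2≤m)}}
... | record { factors = [] ; isFactorisation = m≡1 } = ⊥-elim (<⇒≢ 2≤m (sym m≡1))
... | record { factors = q ∷ qs ; isFactorisation = eq ; factorsPrime = q-prime ∷ _ } =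
  q , q-prime , divides (product qs) (trans eq (*-comm q (product qs)))

1≤m*n⇒1≤m : ∀ {m n} → 1 ≤ m * n → 1 ≤ m
1≤m*n⇒1≤m {suc _} _ = s≤s z≤n

prime-power-split : ∀ {p} → 2 ≤ p → ∀ {m} → 1 ≤ m → ∃₂ λ a r → m ≡ p ^ a * r × ¬ (p ∣ r)
prime-power-split {p} 2≤p {m} 1≤m = split m 1≤m (<-wellFounded m)
  where
  split : ∀ m → 1 ≤ m → Acc _<_ m → ∃₂ λ a r → m ≡ p ^ a * r × ¬ (p ∣ r)
  split m 1≤m (acc rec) with p ∣? m
  ... | no p∤m = 0 , m , sym (+-identityʳ m) , p∤m
  ... | yes (divides q m≡q*p) with split q 1≤q (rec q<m)
    where
    1≤q : 1 ≤ q
    1≤q = 1≤m*n⇒1≤m (subst (1 ≤_) m≡q*p 1≤m)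
    q<m : q < m
    q<m = <-≤-trans (m<m*n q p {{>-nonZero 1≤q}} 2≤p) (≤-reflexive (sym m≡q*p))
  ... | a , r , q≡p^a*r , p∤r = suc a , r , trans m≡q*p (trans (cong (_* p) q≡p^a*r) (rearrange (p ^ a) r p)) , p∤r
    where
    rearrange : ∀ x r p → x * r * p ≡ p * x * r
    rearrange = solve-∀

-- ∏_{p ≤ j prime} p ^ ⌊log_p M⌋; for j = M a common multiple of 1, …, M.
primePowerProduct : ℕ → ℕ → ℕ
primePowerProduct M zero    = 1
primePowerProduct M (suc j) with prime? (suc j)
... | yes _ = primePowerProduct M j * suc j ^ largestExponent (suc j) M
... | no _  = primePowerProduct M j

primePowerProduct≤M^primeCount : ∀ {M} j → 1 ≤ M → primePowerProduct M j ≤ M ^ primeCount j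
primePowerProduct≤M^primeCount zero    1≤M = ≤-refl
primePowerProduct≤M^primeCount {M} (suc j) 1≤M with prime? (suc j)
... | yes p = begin
  primePowerProduct M j * suc j ^ largestExponent (suc j) M
      ≤⟨ *-mono-≤ (primePowerProduct≤M^primeCount j 1≤M) (largestExponent-^≤ (suc j) 1≤M) ⟩
  M ^ primeCount j * M   ≡⟨ *-comm (M ^ primeCount j) M ⟩
  M ^ suc (primeCount j) ≡⟨ cong (M ^_) (sym (count-suc-yes prime? j p)) ⟩
  M ^ primeCount (suc j) ∎
  where open ≤-Reasoning
... | no ¬p = ≤-trans (primePowerProduct≤M^primeCount j 1≤M) (≤-reflexive (cong (M ^_) (sym (count-suc-no prime? j ¬p))))

primePowerProduct>0 : ∀ M j → 0 < primePowerProduct M j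
primePowerProduct>0 M zero = s≤s z≤n
primePowerProduct>0 M (suc j) with prime? (suc j)
... | yes _ = *-mono-≤ (primePowerProduct>0 M j) (m^n>0 (suc j) (largestExponent (suc j) M))
... | no _  = primePowerProduct>0 M j

∣primePowerProduct : ∀ {M} j {m} → 1 ≤ m → m ≤ M → (∀ {q} → Prime q → q ∣ m → q ≤ j) → m ∣ primePowerProduct M j
∣primePowerProduct zero {suc zero}    _ _ _ = ∣-refl
∣primePowerProduct zero {suc (suc m)} _ _ factors≤0 with ∃prime∣ {suc (suc m)} (s≤s (s≤s z≤n))
... | q , q-prime , q∣m = ⊥-elim (<⇒≱ (prime⇒2≤ q-prime) (≤-trans (factors≤0 q-prime q∣m) z≤n))
∣primePowerProduct {M} (suc j) {m} 1≤m m≤M factors≤1+j with prime? (suc j)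
... | no ¬p = ∣primePowerProduct j 1≤m m≤M factors≤j
  where
  factors≤j : ∀ {q} → Prime q → q ∣ m → q ≤ j
  factors≤j q-prime q∣m with m≤n⇒m<n∨m≡n (factors≤1+j q-prime q∣m)
  ... | inj₁ q<1+j = ≤-pred q<1+j
  ... | inj₂ refl  = contradiction q-prime ¬p
... | yes p-prime with prime-power-split (prime⇒2≤ p-prime) 1≤m
... | a , r , m≡p^a*r , p∤r = subst (_∣ primePowerProduct M j * p ^ e) (sym m≡p^a*r)
        (subst (p ^ a * r ∣_) (*-comm (p ^ e) _) (*-pres-∣ p^a∣p^e r∣rest))
  where
  p = suc j
  e = largestExponent p M
  instance
    m≢0 : NonZero m
    m≢0 = >-nonZero 1≤m
  r∣m : r ∣ m
  r∣m = divides (p ^ a) m≡p^a*r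
  p^a∣m : p ^ a ∣ m
  p^a∣m = divides r (trans m≡p^a*r (*-comm (p ^ a) r))
  factors≤j : ∀ {q} → Prime q → q ∣ r → q ≤ j
  factors≤j q-prime q∣r with m≤n⇒m<n∨m≡n (factors≤1+j q-prime (∣-trans q∣r r∣m))
  ... | inj₁ q<1+j = ≤-pred q<1+j
  ... | inj₂ refl  = contradiction q∣r p∤r
  1≤r : 1 ≤ r
  1≤r = 1≤m*n⇒1≤m (subst (1 ≤_) (trans m≡p^a*r (*-comm (p ^ a) r)) 1≤m)
  r∣rest : r ∣ primePowerProduct M j
  r∣rest = ∣primePowerProduct j 1≤r (≤-trans (∣⇒≤ r∣m) m≤M) factors≤j
  p^a∣p^e : p ^ a ∣ p ^ e
  p^a∣p^e = ^-monoʳ-∣ p {a} (largestExponent-maximal (prime⇒2≤ p-prime) (≤-trans (∣⇒≤ p^a∣m) m≤M))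

module _ {L M : ℕ} (∣L : ∀ {i} → 1 ≤ i → i ≤ M → i ∣ L) where

  -- Nair's argument: induction on b via L (a+1)! b! + L a! (b+1)! = (a+b+2) L a! b!.
  suc[a+b]!∣L*a!*b! : ∀ a b → suc (a + b) ≤ M → suc (a + b) ! ∣ L * a ! * b !
  suc[a+b]!∣L*a!*b! a zero a+1≤M = subst (λ s → suc s ! ∣ L * a ! * 1) (sym (+-identityʳ a))
    (subst (suc a ! ∣_) (sym (*-identityʳ (L * a !)))
      (*-monoˡ-∣ (a !) (∣L (s≤s z≤n) (subst (λ s → suc s ≤ M) (+-identityʳ a) a+1≤M))))
  suc[a+b]!∣L*a!*b! a (suc b) a+b+2≤M = subst (λ s → suc s ! ∣ L * a ! * (suc b * b !)) (sym (+-suc a b)) goal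
    where
    s = a + b
    s+2≤M : suc (suc s) ≤ M
    s+2≤M = subst (λ t → suc t ≤ M) (+-suc a b) a+b+2≤M
    ∣L*a!*b!*[s+2] : suc (suc s) ! ∣ L * a ! * b ! * suc (suc s)
    ∣L*a!*b!*[s+2] = subst (suc (suc s) ! ∣_) (*-comm (suc (suc s)) (L * a ! * b !))
      (*-monoʳ-∣ (suc (suc s)) (suc[a+b]!∣L*a!*b! a b (≤-trans (n≤1+n _) s+2≤M)))
    ∣L*[a+1]!*b! : suc (suc s) ! ∣ L * (suc a * a !) * b !
    ∣L*[a+1]!*b! = suc[a+b]!∣L*a!*b! (suc a) b s+2≤M
    pascal : ∀ L A B a b → L * (suc a * A) * B + L * A * (suc b * B) ≡ L * A * B * suc (suc (a + b))
    pascal = solve-∀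
    goal : suc (suc s) ! ∣ L * a ! * (suc b * b !)
    goal = ∣m+n∣m⇒∣n (subst (suc (suc s) ! ∣_) (sym (pascal L (a !) (b !) a b)) ∣L*a!*b!*[s+2]) ∣L*[a+1]!*b!

4^n*[n!*n!]≤[1+2n]! : ∀ n → 4 ^ n * (n ! * n !) ≤ suc (n + n) !
4^n*[n!*n!]≤[1+2n]! zero    = ≤-refl
4^n*[n!*n!]≤[1+2n]! (suc n) = begin
  4 * 4 ^ n * (suc n * n ! * (suc n * n !))
      ≡⟨ regroup (4 ^ n) n (n !) ⟩
  (4 * suc n * suc n) * (4 ^ n * (n ! * n !))
      ≤⟨ *-mono-≤ 4[n+1]²≤[2n+3][2n+2] (4^n*[n!*n!]≤[1+2n]! n) ⟩
  (suc (suc (suc (n + n))) * suc (suc (n + n))) * suc (n + n) !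
      ≡⟨ *-assoc (suc (suc (suc (n + n)))) (suc (suc (n + n))) (suc (n + n) !) ⟩
  suc (suc (suc (n + n))) * (suc (suc (n + n)) * suc (n + n) !)
      ≡⟨ cong (λ m → suc (suc m) !) (sym (+-suc n n)) ⟩
  suc (suc n + suc n) ! ∎
  where
  open ≤-Reasoning
  regroup : ∀ p n f → 4 * p * (suc n * f * (suc n * f)) ≡ (4 * suc n * suc n) * (p * (f * f))
  regroup = solve-∀
  expand : ∀ n → suc (suc (suc (n + n))) * suc (suc (n + n)) ≡ 4 * suc n * suc n + (2 + 2 * n)
  expand = solve-∀
  4[n+1]²≤[2n+3][2n+2] : 4 * suc n * suc n ≤ suc (suc (suc (n + n))) * suc (suc (n + n))
  4[n+1]²≤[2n+3][2n+2] = ≤-trans (m≤m+n _ _) (≤-reflexive (sym (expand n)))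

4^n≤commonMultiple : ∀ n {L} → 0 < L → (∀ {i} → 1 ≤ i → i ≤ suc (n + n) → i ∣ L) → 4 ^ n ≤ L
4^n≤commonMultiple n {L} 0<L ∣L = *-cancelʳ-≤ (4 ^ n) L (n ! * n !) {{m*n≢0 (n !) (n !) {{n !≢0}} {{n !≢0}}}} (begin
  4 ^ n * (n ! * n !)   ≤⟨ 4^n*[n!*n!]≤[1+2n]! n ⟩
  suc (n + n) !         ≤⟨ ∣⇒≤ {{L*n!*n!≢0}} (subst (suc (n + n) ! ∣_) (*-assoc L (n !) (n !)) (suc[a+b]!∣L*a!*b! ∣L n n ≤-refl)) ⟩
  L * (n ! * n !)       ∎)
  where
  open ≤-Reasoning
  L*n!*n!≢0 : NonZero (L * (n ! * n !))
  L*n!*n!≢0 = m*n≢0 L (n ! * n !) {{>-nonZero 0<L}} {{m*n≢0 (n !) (n !) {{n !≢0}} {{n !≢0}}}}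

4^n≤[1+2n]^primeCount : ∀ n → 4 ^ n ≤ suc (n + n) ^ primeCount (suc (n + n))
4^n≤[1+2n]^primeCount n = ≤-trans
  (4^n≤commonMultiple n (primePowerProduct>0 M M)
    (λ 1≤i i≤M → ∣primePowerProduct M 1≤i i≤M (λ _ q∣i → ≤-trans (∣⇒≤ {{>-nonZero 1≤i}} q∣i) i≤M)))
  (primePowerProduct≤M^primeCount M (s≤s z≤n))
  where M = suc (n + n)

2^n≤4*n^primeCount : ∀ n → 1 ≤ n → 2 ^ n ≤ 4 * n ^ primeCount n
2^n≤4*n^primeCount (suc m) _ = begin
  2 ^ suc m                         ≤⟨ ^-monoʳ-≤ 2 (s≤s m≤1+2h) ⟩
  2 * (2 * 2 ^ (h + h))             ≡⟨ sym (*-assoc 2 2 (2 ^ (h + h))) ⟩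
  4 * 2 ^ (h + h)                   ≡⟨ cong (4 *_) (sym 4^h≡2^[h+h]) ⟩
  4 * 4 ^ h                         ≤⟨ *-monoʳ-≤ 4 (4^n≤[1+2n]^primeCount h) ⟩
  4 * suc (h + h) ^ primeCount (suc (h + h))
      ≤⟨ *-monoʳ-≤ 4 (≤-trans (^-monoˡ-≤ (primeCount (suc (h + h))) 1+2h≤1+m) (^-monoʳ-≤ (suc m) (count-mono-≤ prime? 1+2h≤1+m))) ⟩
  4 * suc m ^ primeCount (suc m)    ∎
  where
  open ≤-Reasoning
  h = ⌊ m /2⌋
  1+2h≤1+m : suc (h + h) ≤ suc m
  1+2h≤1+m = s≤s (≤-trans (+-monoʳ-≤ h (⌊n/2⌋≤⌈n/2⌉ m)) (≤-reflexive (⌊n/2⌋+⌈n/2⌉≡n m)))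
  m≤1+2h : m ≤ suc (h + h)
  m≤1+2h = begin
    m                 ≡⟨ sym (⌊n/2⌋+⌈n/2⌉≡n m) ⟩
    h + ⌈ m /2⌉       ≤⟨ +-monoʳ-≤ h (⌊n/2⌋-mono (n≤1+n (suc m))) ⟩
    h + suc h         ≡⟨ +-suc h h ⟩
    suc (h + h)       ∎
  4^h≡2^[h+h] : 4 ^ h ≡ 2 ^ (h + h)
  4^h≡2^[h+h] = trans (^-*-assoc 2 2 h) (cong (λ e → 2 ^ (h + e)) (+-identityʳ h))

count-≤-+ : {P Q R : Pred ℕ 0ℓ} (P? : Decidable P) (Q? : Decidable Q) (R? : Decidable R) →
            (∀ {x} → P x → Q x ⊎ R x) → ∀ n → count P? n ≤ count Q? n + count R? n
count-≤-+ P? Q? R? P⊆Q∪R zero = z≤n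
count-≤-+ P? Q? R? P⊆Q∪R (suc n) with P? (suc n)
... | no ¬p = begin
  count P? (suc n)          ≡⟨ count-suc-no P? n ¬p ⟩
  count P? n                ≤⟨ count-≤-+ P? Q? R? P⊆Q∪R n ⟩
  count Q? n + count R? n   ≤⟨ +-mono-≤ (count-mono-≤ Q? (n≤1+n n)) (count-mono-≤ R? (n≤1+n n)) ⟩
  count Q? (suc n) + count R? (suc n) ∎
  where open ≤-Reasoning
... | yes p with P⊆Q∪R p
...   | inj₁ q = begin
  count P? (suc n)          ≡⟨ count-suc-yes P? n p ⟩
  suc (count P? n)          ≤⟨ s≤s (count-≤-+ P? Q? R? P⊆Q∪R n) ⟩
  suc (count Q? n) + count R? n ≡⟨ cong (_+ count R? n) (sym (count-suc-yes Q? n q)) ⟩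
  count Q? (suc n) + count R? n ≤⟨ +-monoʳ-≤ (count Q? (suc n)) (count-mono-≤ R? (n≤1+n n)) ⟩
  count Q? (suc n) + count R? (suc n) ∎
  where open ≤-Reasoning
...   | inj₂ r = begin
  count P? (suc n)          ≡⟨ count-suc-yes P? n p ⟩
  suc (count P? n)          ≤⟨ s≤s (count-≤-+ P? Q? R? P⊆Q∪R n) ⟩
  suc (count Q? n + count R? n) ≡⟨ sym (+-suc (count Q? n) (count R? n)) ⟩
  count Q? n + suc (count R? n) ≡⟨ cong (count Q? n +_) (sym (count-suc-yes R? n r)) ⟩
  count Q? n + count R? (suc n) ≤⟨ +-monoˡ-≤ (count R? (suc n)) (count-mono-≤ Q? (n≤1+n n)) ⟩
  count Q? (suc n) + count R? (suc n) ∎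
  where open ≤-Reasoning

primeDivisor? : (N : ℕ) → Decidable (λ n → Prime n × n ∣ N)
primeDivisor? N n = prime? n ×-dec (n ∣? N)

primeCount≤good+primeDivisors : ∀ N X → primeCount X ≤ count (good? N) X + count (primeDivisor? N) X
primeCount≤good+primeDivisors N = count-≤-+ prime? (good? N) (primeDivisor? N) split
  where
  split : ∀ {n} → Prime n → (Prime n × ¬ n ∣ N) ⊎ (Prime n × n ∣ N)
  split {n} p with n ∣? N
  ... | yes n∣N = inj₂ (p , n∣N)
  ... | no n∤N  = inj₁ (p , n∤N)

primeDivisorProduct : ℕ → ℕ → ℕ
primeDivisorProduct N X = product (filter (primeDivisor? N) (range1 X))

module _ (N : ℕ) where

  primeDivisorProduct-suc-yes : ∀ X → Prime (suc X) × suc X ∣ N → primeDivisorProduct N (suc X) ≡ primeDivisorProduct N X * suc X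
  primeDivisorProduct-suc-yes X p = trans (cong product (filter-range1-suc-yes (primeDivisor? N) X p))
    (trans (product-++ (filter (primeDivisor? N) (range1 X)) (suc X ∷ [])) (cong (primeDivisorProduct N X *_) (*-identityʳ (suc X))))

  primeDivisorProduct-suc-no : ∀ X → ¬ (Prime (suc X) × suc X ∣ N) → primeDivisorProduct N (suc X) ≡ primeDivisorProduct N X
  primeDivisorProduct-suc-no X ¬p = cong product (filter-range1-suc-no (primeDivisor? N) X ¬p)

  prime∣primeDivisorProduct⇒≤ : ∀ X {q} → Prime q → q ∣ primeDivisorProduct N X → q ≤ X
  prime∣primeDivisorProduct⇒≤ zero    q-prime q∣1 = contradiction (∣⇒≤ q∣1) (<⇒≱ (prime⇒2≤ q-prime))
  prime∣primeDivisorProduct⇒≤ (suc X) q-prime q∣D with primeDivisor? N (suc X)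
  ... | no ¬p = m≤n⇒m≤1+n (prime∣primeDivisorProduct⇒≤ X q-prime (subst (_ ∣_) (primeDivisorProduct-suc-no X ¬p) q∣D))
  ... | yes p with euclidsLemma (primeDivisorProduct N X) (suc X) q-prime (subst (_ ∣_) (primeDivisorProduct-suc-yes X p) q∣D)
  ...   | inj₁ q∣D' = m≤n⇒m≤1+n (prime∣primeDivisorProduct⇒≤ X q-prime q∣D')
  ...   | inj₂ q∣1+X = ∣⇒≤ q∣1+X

  primeDivisorProduct∣ : ∀ X → primeDivisorProduct N X ∣ N
  primeDivisorProduct∣ zero = 1∣ N
  primeDivisorProduct∣ (suc X) with primeDivisor? N (suc X)
  ... | no ¬p = subst (_∣ N) (sym (primeDivisorProduct-suc-no X ¬p)) (primeDivisorProduct∣ X)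
  ... | yes p@(p-prime , p∣N) = subst (_∣ N) (sym (primeDivisorProduct-suc-yes X p)) D*p∣N
    where
    D = primeDivisorProduct N X
    c = quotient (primeDivisorProduct∣ X)
    N≡c*D : N ≡ c * D
    N≡c*D = _∣_.equality (primeDivisorProduct∣ X)
    p∤D : ¬ suc X ∣ D
    p∤D p∣D = contradiction (prime∣primeDivisorProduct⇒≤ X p-prime p∣D) (<⇒≱ (n<1+n X))
    p∣c : suc X ∣ c
    p∣c with euclidsLemma c D p-prime (subst (suc X ∣_) N≡c*D p∣N)
    ... | inj₁ p∣c = p∣c
    ... | inj₂ p∣D = contradiction p∣D p∤D
    D*p∣N : D * suc X ∣ N
    D*p∣N = subst (_∣ N) (*-comm (suc X) D) (subst (suc X * D ∣_) (sym N≡c*D) (*-monoˡ-∣ D p∣c))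

  2^count≤primeDivisorProduct : ∀ X → 2 ^ count (primeDivisor? N) X ≤ primeDivisorProduct N X
  2^count≤primeDivisorProduct zero = ≤-refl
  2^count≤primeDivisorProduct (suc X) with primeDivisor? N (suc X)
  ... | no ¬p = subst₂ (λ c D → 2 ^ c ≤ D) (sym (count-suc-no (primeDivisor? N) X ¬p)) (sym (primeDivisorProduct-suc-no X ¬p))
                  (2^count≤primeDivisorProduct X)
  ... | yes p@(p-prime , _) = begin
    2 ^ count (primeDivisor? N) (suc X)           ≡⟨ cong (2 ^_) (count-suc-yes (primeDivisor? N) X p) ⟩
    2 * 2 ^ count (primeDivisor? N) X             ≡⟨ *-comm 2 (2 ^ count (primeDivisor? N) X) ⟩
    2 ^ count (primeDivisor? N) X * 2             ≤⟨ *-mono-≤ (2^count≤primeDivisorProduct X) (prime⇒2≤ p-prime) ⟩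
    primeDivisorProduct N X * suc X               ≡⟨ sym (primeDivisorProduct-suc-yes X p) ⟩
    primeDivisorProduct N (suc X)                 ∎
    where open ≤-Reasoning

  2^primeDivisorCount≤N : ∀ X → 0 < N → 2 ^ count (primeDivisor? N) X ≤ N
  2^primeDivisorCount≤N X 0<N = ≤-trans (2^count≤primeDivisorProduct X) (∣⇒≤ {{>-nonZero 0<N}} (primeDivisorProduct∣ X))

length-tuples : ∀ k (xs : List ℕ) → length (tuples k xs) ≡ length xs ^ k
length-tuples zero    xs = refl
length-tuples (suc k) xs = prefixed xs
  where
  prefixed : ∀ ys → length (concatMap (λ x → map (x ∷_) (tuples k xs)) ys) ≡ length ys * length xs ^ k
  prefixed []       = refl
  prefixed (y ∷ ys) = trans (length-++ (map (y ∷_) (tuples k xs)))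
    (cong₂ _+_ (trans (length-map (y ∷_) (tuples k xs)) (length-tuples k xs)) (prefixed ys))

length-filter-map : {A B : Set} {P : Pred B 0ℓ} {Q : Pred A 0ℓ} (P? : Decidable P) (Q? : Decidable Q) (f : A → B) →
                    (∀ x → does (P? (f x)) ≡ does (Q? x)) → ∀ xs → length (filter P? (map f xs)) ≡ length (filter Q? xs)
length-filter-map P? Q? f agree []       = refl
length-filter-map P? Q? f agree (x ∷ xs) with does (P? (f x)) | does (Q? x) | agree x
... | true  | .true  | refl = cong suc (length-filter-map P? Q? f agree xs)
... | false | .false | refl = length-filter-map P? Q? f agree xs

module Hits {P : Pred ℕ 0ℓ} (P? : Decidable P) (xs : List ℕ) where

  hits : List ℕ → ℕ
  hits t = length (filter P? t)

  fewIn : ℕ → List (List ℕ) → ℕ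
  fewIn j ts = length (filter (λ t → hits t <? j) ts)

  fewHits : ℕ → ℕ → ℕ
  fewHits k j = fewIn j (tuples k xs)

  fewIn-++ : ∀ j ts us → fewIn j (ts ++ us) ≡ fewIn j ts + fewIn j us
  fewIn-++ j ts us = trans (cong length (filter-++ (λ t → hits t <? j) ts us)) (length-++ (filter _ ts))

  len good bad : ℕ
  len  = length xs
  good = length (filter P? xs)
  bad  = length (filter (∁? P?) xs)

  good+bad≡len : good + bad ≡ len
  good+bad≡len = split xs
    where
    split : ∀ ys → length (filter P? ys) + length (filter (∁? P?) ys) ≡ length ys
    split []       = refl
    split (y ∷ ys) with P? y
    ... | yes _ = cong suc (split ys)
    ... | no _  = trans (+-suc _ _) (cong suc (split ys))

  hits-yes : ∀ {y} t → P y → hits (y ∷ t) ≡ suc (hits t)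
  hits-yes {y} t p with P? y
  ... | yes _ = refl
  ... | no ¬p = contradiction p ¬p

  hits-no : ∀ {y} t → ¬ P y → hits (y ∷ t) ≡ hits t
  hits-no {y} t ¬p with P? y
  ... | yes p = contradiction p ¬p
  ... | no _  = refl

  fewIn-prefix-yes : ∀ {y} j ts → P y → fewIn (suc j) (map (y ∷_) ts) ≡ fewIn j ts
  fewIn-prefix-yes j ts p = length-filter-map _ _ (_ ∷_) (λ t → cong (λ h → does (h <? suc j)) (hits-yes t p)) ts

  fewIn-prefix-no : ∀ {y} j ts → ¬ P y → fewIn j (map (y ∷_) ts) ≡ fewIn j ts
  fewIn-prefix-no j ts ¬p = length-filter-map _ _ (_ ∷_) (λ t → cong (λ h → does (h <? j)) (hits-no t ¬p)) ts

  fewHits-suc : ∀ k j → fewHits (suc k) (suc j) ≡ good * fewHits k j + bad * fewHits k (suc j)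
  fewHits-suc k j = byHead xs
    where
    open ≡-Reasoning
    T = tuples k xs
    byHead : ∀ ys → fewIn (suc j) (concatMap (λ y → map (y ∷_) T) ys)
                   ≡ length (filter P? ys) * fewHits k j + length (filter (∁? P?) ys) * fewHits k (suc j)
    byHead []       = refl
    byHead (y ∷ ys) with P? y
    ... | yes p = begin
      fewIn (suc j) (map (y ∷_) T ++ rest)
        ≡⟨ fewIn-++ (suc j) (map (y ∷_) T) rest ⟩
      fewIn (suc j) (map (y ∷_) T) + fewIn (suc j) rest
        ≡⟨ cong₂ _+_ (fewIn-prefix-yes j T p) (byHead ys) ⟩
      fewHits k j + (g * fewHits k j + b * fewHits k (suc j))
        ≡⟨ sym (+-assoc (fewHits k j) _ _) ⟩
      suc g * fewHits k j + b * fewHits k (suc j)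
        ∎
      where
      rest = concatMap (λ y → map (y ∷_) T) ys
      g = length (filter P? ys)
      b = length (filter (∁? P?) ys)
    ... | no ¬p = begin
      fewIn (suc j) (map (y ∷_) T ++ rest)
        ≡⟨ fewIn-++ (suc j) (map (y ∷_) T) rest ⟩
      fewIn (suc j) (map (y ∷_) T) + fewIn (suc j) rest
        ≡⟨ cong₂ _+_ (fewIn-prefix-no (suc j) T ¬p) (byHead ys) ⟩
      fewHits k (suc j) + (g * fewHits k j + b * fewHits k (suc j))
        ≡⟨ x+[y+z]≡y+[x+z] (fewHits k (suc j)) (g * fewHits k j) (b * fewHits k (suc j)) ⟩
      g * fewHits k j + suc b * fewHits k (suc j)
        ∎
      where
      rest = concatMap (λ y → map (y ∷_) T) ys
      g = length (filter P? ys)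
      b = length (filter (∁? P?) ys)
      x+[y+z]≡y+[x+z] : ∀ x y z → x + (y + z) ≡ y + (x + z)
      x+[y+z]≡y+[x+z] = solve-∀

  good≤len : good ≤ len
  good≤len = ≤-trans (m≤m+n good bad) (≤-reflexive good+bad≡len)

  bad≤len : bad ≤ len
  bad≤len = ≤-trans (m≤n+m bad good) (≤-reflexive good+bad≡len)

  fewHits≤len^k : ∀ k j → fewHits k j ≤ len ^ k
  fewHits≤len^k k j = ≤-trans (length-filter _ (tuples k xs)) (≤-reflexive (length-tuples k xs))

  fewIn-zero : ∀ ts → fewIn 0 ts ≡ 0
  fewIn-zero []       = refl
  fewIn-zero (t ∷ ts) = fewIn-zero ts

  fewHits≤ : 0 < len → ∀ k j → fewHits k j ≤ suc k ^ j * len ^ j * bad ^ (k ∸ j)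
  fewHits≤ 0<len zero    zero    = z≤n
  fewHits≤ 0<len zero    (suc j) = *-mono-≤ (*-mono-≤ (m^n>0 1 (suc j)) (m^n>0 len {{>-nonZero 0<len}} (suc j))) ≤-refl
  fewHits≤ 0<len (suc k) zero    = subst (_≤ suc (suc k) ^ 0 * len ^ 0 * bad ^ suc k) (sym (fewIn-zero (tuples (suc k) xs))) z≤n
  fewHits≤ 0<len (suc k) (suc j) = begin
    fewHits (suc k) (suc j)
      ≡⟨ fewHits-suc k j ⟩
    good * fewHits k j + bad * fewHits k (suc j)
      ≤⟨ +-mono-≤ (*-mono-≤ good≤len (fewHits≤ 0<len k j)) misses ⟩
    len * (suc k ^ j * len ^ j * bad^[k∸j]) + suc k ^ suc j * len ^ suc j * bad^[k∸j]
      ≡⟨ collect len (suc k ^ j) (len ^ j) bad^[k∸j] (suc k) ⟩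
    suc (suc k) * suc k ^ j * len ^ suc j * bad^[k∸j]
      ≤⟨ *-monoˡ-≤ bad^[k∸j] (*-monoˡ-≤ (len ^ suc j) (*-monoʳ-≤ (suc (suc k)) (^-monoˡ-≤ j (n≤1+n (suc k))))) ⟩
    suc (suc k) ^ suc j * len ^ suc j * bad^[k∸j]
      ∎
    where
    open ≤-Reasoning
    bad^[k∸j] = bad ^ (k ∸ j)
    instance
      len≢0 : NonZero len
      len≢0 = >-nonZero 0<len
    collect : ∀ x a b y s → x * (a * b * y) + s * a * (x * b) * y ≡ (suc s * a) * (x * b) * y
    collect = solve-∀
    misses : bad * fewHits k (suc j) ≤ suc k ^ suc j * len ^ suc j * bad^[k∸j]
    misses with j <? k
    ... | yes j<k = begin
      bad * fewHits k (suc j)                                  ≤⟨ *-monoʳ-≤ bad (fewHits≤ 0<len k (suc j)) ⟩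
      bad * (suc k ^ suc j * len ^ suc j * bad ^ (k ∸ suc j))  ≡⟨ x∙yz≈y∙xz bad (suc k ^ suc j * len ^ suc j) (bad ^ (k ∸ suc j)) ⟩
      suc k ^ suc j * len ^ suc j * bad ^ suc (k ∸ suc j)      ≡⟨ cong (λ e → suc k ^ suc j * len ^ suc j * bad ^ e) (sym (+-∸-assoc 1 j<k)) ⟩
      suc k ^ suc j * len ^ suc j * bad^[k∸j]                  ∎
    ... | no j≮k = begin
      bad * fewHits k (suc j)                   ≤⟨ *-mono-≤ bad≤len (fewHits≤len^k k (suc j)) ⟩
      len ^ suc k                               ≤⟨ ^-monoʳ-≤ len (s≤s (≮⇒≥ j≮k)) ⟩
      len ^ suc j                               ≤⟨ m≤n*m (len ^ suc j) (suc k ^ suc j) {{m^n≢0 (suc k) (suc j)}} ⟩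
      suc k ^ suc j * len ^ suc j               ≡⟨ sym (*-identityʳ _) ⟩
      suc k ^ suc j * len ^ suc j * bad ^ 0     ≡⟨ cong (λ e → suc k ^ suc j * len ^ suc j * bad ^ e) (sym (m≤n⇒m∸n≡0 (≮⇒≥ j≮k))) ⟩
      suc k ^ suc j * len ^ suc j * bad^[k∸j]   ∎

bernoulli : ∀ q j → q ^ j * (q + j) ≤ q * suc q ^ j
bernoulli q zero    = ≤-reflexive (trans (*-identityˡ (q + 0)) (trans (+-identityʳ q) (sym (*-identityʳ q))))
bernoulli q (suc j) = begin
  q * q ^ j * (q + suc j)                 ≤⟨ m≤m+n _ (q ^ j * j) ⟩
  q * q ^ j * (q + suc j) + q ^ j * j     ≡⟨ regroup q (q ^ j) j ⟩
  suc q * (q ^ j * (q + j))               ≤⟨ *-monoʳ-≤ (suc q) (bernoulli q j) ⟩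
  suc q * (q * suc q ^ j)                 ≡⟨ x∙yz≈y∙xz (suc q) q (suc q ^ j) ⟩
  q * (suc q * suc q ^ j)                 ∎
  where
  open ≤-Reasoning
  regroup : ∀ q p j → q * p * (q + suc j) + p * j ≡ suc q * (p * (q + j))
  regroup = solve-∀

2*q^q≤[1+q]^q : ∀ q → 0 < q → 2 * q ^ q ≤ suc q ^ q
2*q^q≤[1+q]^q q 0<q = *-cancelˡ-≤ q {{>-nonZero 0<q}} (begin
  q * (2 * q ^ q)     ≡⟨ rearrange q (q ^ q) ⟩
  q ^ q * (q + q)     ≤⟨ bernoulli q q ⟩
  q * suc q ^ q       ∎)
  where
  open ≤-Reasoning
  rearrange : ∀ q p → q * (2 * p) ≡ p * (q + q)
  rearrange = solve-∀

-- y ≤ (1 − 1/q) x and (1 − 1/q)^q ≤ 1/2.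
y^k*2^s≤x^k : ∀ {x y g q s k} → g + y ≡ x → x ≤ q * g → 0 < q → q * s ≤ k → y ^ k * 2 ^ s ≤ x ^ k
y^k*2^s≤x^k {x} {y} {g} {q} {s} {k} g+y≡x x≤qg 0<q qs≤k =
  *-cancelʳ-≤ (y ^ k * 2 ^ s) (x ^ k) (q ^ k) {{m^n≢0 q k {{>-nonZero 0<q}}}} (begin
    y ^ k * 2 ^ s * q ^ k       ≡⟨ *-assoc (y ^ k) (2 ^ s) (q ^ k) ⟩
    y ^ k * (2 ^ s * q ^ k)     ≤⟨ *-monoʳ-≤ (y ^ k) 2^s*q^k≤[1+q]^k ⟩
    y ^ k * suc q ^ k           ≡⟨ sym (^-distribʳ-* y (suc q) k) ⟩
    (y * suc q) ^ k             ≤⟨ ^-monoˡ-≤ k y[1+q]≤xq ⟩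
    (x * q) ^ k                 ≡⟨ ^-distribʳ-* x q k ⟩
    x ^ k * q ^ k               ∎)
  where
  open ≤-Reasoning
  r = k ∸ q * s
  qs+r≡k : q * s + r ≡ k
  qs+r≡k = m+[n∸m]≡n qs≤k
  y[1+q]≤xq : y * suc q ≤ x * q
  y[1+q]≤xq = begin
    y * suc q         ≡⟨ *-suc y q ⟩
    y + y * q         ≤⟨ +-monoˡ-≤ (y * q) (≤-trans (m≤n+m y g) (≤-trans (≤-reflexive g+y≡x) x≤qg)) ⟩
    q * g + y * q     ≡⟨ cong (_+ y * q) (*-comm q g) ⟩
    g * q + y * q     ≡⟨ sym (*-distribʳ-+ q g y) ⟩
    (g + y) * q       ≡⟨ cong (_* q) g+y≡x ⟩
    x * q             ∎
  2^s*q^k≤[1+q]^k : 2 ^ s * q ^ k ≤ suc q ^ k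
  2^s*q^k≤[1+q]^k = begin
    2 ^ s * q ^ k                       ≡⟨ cong (λ e → 2 ^ s * q ^ e) (sym qs+r≡k) ⟩
    2 ^ s * q ^ (q * s + r)             ≡⟨ cong (2 ^ s *_) (^-distribˡ-+-* q (q * s) r) ⟩
    2 ^ s * (q ^ (q * s) * q ^ r)       ≡⟨ sym (*-assoc (2 ^ s) _ _) ⟩
    2 ^ s * q ^ (q * s) * q ^ r         ≡⟨ cong (λ z → 2 ^ s * z * q ^ r) (sym (^-*-assoc q q s)) ⟩
    2 ^ s * (q ^ q) ^ s * q ^ r         ≡⟨ cong (_* q ^ r) (sym (^-distribʳ-* 2 (q ^ q) s)) ⟩
    (2 * q ^ q) ^ s * q ^ r             ≤⟨ *-mono-≤ (^-monoˡ-≤ s (2*q^q≤[1+q]^q q 0<q)) (^-monoˡ-≤ r (n≤1+n q)) ⟩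
    (suc q ^ q) ^ s * suc q ^ r         ≡⟨ cong (_* suc q ^ r) (^-*-assoc (suc q) q s) ⟩
    suc q ^ (q * s) * suc q ^ r         ≡⟨ sym (^-distribˡ-+-* (suc q) (q * s) r) ⟩
    suc q ^ (q * s + r)                 ≡⟨ cong (suc q ^_) qs+r≡k ⟩
    suc q ^ k                           ∎

length-range1 : ∀ n → length (range1 n) ≡ n
length-range1 zero    = refl
length-range1 (suc n) = trans (length-++ (range1 n)) (trans (cong (_+ 1) (length-range1 n)) (+-comm n 1))

2^m≤2^n⇒m≤n : ∀ {m n} → 2 ^ m ≤ 2 ^ n → m ≤ n
2^m≤2^n⇒m≤n 2^m≤2^n = ≮⇒≥ λ n<m → <⇒≱ (^-monoʳ-< 2 (s≤s (s≤s z≤n)) n<m) 2^m≤2^n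

2^m<2^n⇒m<n : ∀ {m n} → 2 ^ m < 2 ^ n → m < n
2^m<2^n⇒m<n 2^m<2^n = ≰⇒> λ n≤m → <⇒≱ 2^m<2^n (^-monoʳ-≤ 2 n≤m)

log₂-bracket : ∀ n → ∃ λ b → 2 ^ b ≤ suc n × suc n < 2 ^ suc b
log₂-bracket zero    = 0 , ≤-refl , s≤s (s≤s z≤n)
log₂-bracket (suc n) with log₂-bracket n
... | b , 2^b≤1+n , 1+n<2^[1+b] with suc (suc n) <? 2 ^ suc b
...   | yes 2+n<2^[1+b] = b , m≤n⇒m≤1+n 2^b≤1+n , 2+n<2^[1+b]
...   | no 2+n≮2^[1+b]  = suc b , ≤-reflexive 2^[1+b]≡2+n , subst (_< 2 ^ suc (suc b)) 2^[1+b]≡2+n x<2*x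
  where
  x = 2 ^ suc b
  x<2*x : x < 2 * x
  x<2*x = <-≤-trans (m<m+n x (m^n>0 2 (suc b))) (≤-reflexive (cong (x +_) (sym (+-identityʳ x))))
  2^[1+b]≡2+n : 2 ^ suc b ≡ suc (suc n)
  2^[1+b]≡2+n = ≤-antisym (≮⇒≥ 2+n≮2^[1+b]) 1+n<2^[1+b]

c*[1+n]<2^n-step : ∀ c n → c * suc n < 2 ^ n → c * suc (suc n) < 2 ^ suc n
c*[1+n]<2^n-step c n c[1+n]<2^n = begin-strict
  c * suc (suc n)           ≡⟨ *-suc c (suc n) ⟩
  c + c * suc n             <⟨ +-mono-≤-< (≤-trans (m≤m*n c (suc n)) (<⇒≤ c[1+n]<2^n)) c[1+n]<2^n ⟩
  2 ^ n + 2 ^ n             ≡⟨ cong (2 ^ n +_) (sym (+-identityʳ (2 ^ n))) ⟩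
  2 ^ suc n                 ∎
  where open ≤-Reasoning

c*[1+n]<2^n⇒c*[1+t+n]<2^[t+n] : ∀ c n t → c * suc n < 2 ^ n → c * suc (t + n) < 2 ^ (t + n)
c*[1+n]<2^n⇒c*[1+t+n]<2^[t+n] c n zero    base = base
c*[1+n]<2^n⇒c*[1+t+n]<2^[t+n] c n (suc t) base = c*[1+n]<2^n-step c (t + n) (c*[1+n]<2^n⇒c*[1+t+n]<2^[t+n] c n t base)

∃log-scale : ∀ {d} → 2 ^ 18 < d → ∃ λ b → 0 < b × d ≤ 2 ^ b × 10000 * b < d
∃log-scale {suc n} 2^18<d with log₂-bracket n
... | b , 2^b≤d , d<2^[1+b] = suc b , s≤s z≤n , <⇒≤ d<2^[1+b] , <-≤-trans 10000*[1+b]<2^b 2^b≤d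
  where
  18≤b : 18 ≤ b
  18≤b = ≮⇒≥ λ b<18 → <⇒≱ 2^18<d (<⇒≤ (<-≤-trans d<2^[1+b] (^-monoʳ-≤ 2 b<18)))
  10000*[1+b]<2^b : 10000 * suc b < 2 ^ b
  10000*[1+b]<2^b = subst (λ e → 10000 * suc e < 2 ^ e) (m∸n+n≡m 18≤b)
    (c*[1+n]<2^n⇒c*[1+t+n]<2^[t+n] 10000 18 (b ∸ 18) (≤ᵇ⇒≤ _ _ tt))

module _ {N d b : ℕ} (0<N : 0 < N) (N<2^[1+4d²] : N < 2 ^ suc (4 * (d * d)))
         (0<b : 0 < b) (d≤2^b : d ≤ 2 ^ b) (10000b<d : 10000 * b < d) where

  private
    X k B Q : ℕ
    X = d ^ (1000 * d)
    k = d ^ 4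
    B = b * (1000 * d)
    Q = 2 * B

    ω : ℕ
    ω = count (primeDivisor? N) X

    10000≤d : 10000 ≤ d
    10000≤d = ≤-trans (m≤m*n 10000 b {{>-nonZero 0<b}}) (<⇒≤ 10000b<d)

    0<d : 0 < d
    0<d = ≤-trans (s≤s z≤n) 10000≤d

    instance
      d≢0 : NonZero d
      d≢0 = >-nonZero 0<d

    b≤d : b ≤ d
    b≤d = ≤-trans (m≤n*m b 10000) (<⇒≤ 10000b<d)

    2+4b≤d : 2 + b * 4 ≤ d
    2+4b≤d = begin
      2 + b * 4           ≤⟨ s≤s (+-monoˡ-≤ (b * 4) 0<b) ⟩
      suc (b + b * 4)     ≡⟨ cong suc (sym (*-suc b 4)) ⟩
      suc (b * 5)         ≤⟨ s≤s (*-monoʳ-≤ b (≤ᵇ⇒≤ 5 10000 tt)) ⟩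
      suc (b * 10000)     ≡⟨ cong suc (*-comm b 10000) ⟩
      suc (10000 * b)     ≤⟨ 10000b<d ⟩
      d                   ∎
      where open ≤-Reasoning

  open Hits (good? N) (range1 X) using (len; good; bad; good+bad≡len; fewHits≤)

  private
    len≡X : len ≡ X
    len≡X = length-range1 X

    X≤2^B : X ≤ 2 ^ B
    X≤2^B = ≤-trans (^-monoˡ-≤ (1000 * d) d≤2^b) (≤-reflexive (^-*-assoc 2 b (1000 * d)))

    X≤2+B*π : X ≤ 2 + B * primeCount X
    X≤2+B*π = 2^m≤2^n⇒m≤n (begin
      2 ^ X                               ≤⟨ 2^n≤4*n^primeCount X (m^n>0 d (1000 * d)) ⟩
      4 * X ^ primeCount X                ≤⟨ *-monoʳ-≤ 4 (^-monoˡ-≤ (primeCount X) X≤2^B) ⟩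
      4 * (2 ^ B) ^ primeCount X          ≡⟨ cong (4 *_) (^-*-assoc 2 B (primeCount X)) ⟩
      4 * 2 ^ (B * primeCount X)          ≡⟨ *-assoc 2 2 (2 ^ (B * primeCount X)) ⟩
      2 ^ (2 + B * primeCount X)          ∎)
      where open ≤-Reasoning

    ω≤4d² : ω ≤ 4 * (d * d)
    ω≤4d² = ≤-pred (2^m<2^n⇒m<n (≤-<-trans (2^primeDivisorCount≤N N X 0<N) N<2^[1+4d²]))

    4+Q*4d²≤X : 4 + Q * (4 * (d * d)) ≤ X
    4+Q*4d²≤X = begin
      4 + Q * (4 * (d * d))         ≡⟨ cong (4 +_) (expand b d) ⟩
      4 + 8000 * (b * d³)           ≤⟨ +-monoʳ-≤ 4 (*-monoʳ-≤ 8000 (*-monoˡ-≤ d³ b≤d)) ⟩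
      4 + 8000 * d ^ 4              ≤⟨ +-monoˡ-≤ (8000 * d ^ 4) (*-monoʳ-≤ 4 (m^n>0 d 4)) ⟩
      4 * d ^ 4 + 8000 * d ^ 4      ≡⟨ sym (*-distribʳ-+ (d ^ 4) 4 8000) ⟩
      8004 * d ^ 4                  ≤⟨ *-monoˡ-≤ (d ^ 4) (≤-trans (≤ᵇ⇒≤ 8004 10000 tt) 10000≤d) ⟩
      d ^ 5                         ≤⟨ ^-monoʳ-≤ d (≤-trans (≤ᵇ⇒≤ 5 1000 tt) (m≤m*n 1000 d)) ⟩
      X                             ∎
      where
      open ≤-Reasoning
      d³ = d ^ 3
      expand : ∀ b d → 2 * (b * (1000 * d)) * (4 * (d * d)) ≡ 8000 * (b * (d * (d * (d * 1))))
      expand = solve-∀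

    good+bad≡X : good + bad ≡ X
    good+bad≡X = trans good+bad≡len len≡X

    X≤Q*good : X ≤ Q * good
    X≤Q*good = +-cancelˡ-≤ X X (Q * good) (begin
      X + X                                 ≤⟨ +-mono-≤ X≤2+B*π X≤2+B*π ⟩
      (2 + B * π) + (2 + B * π)             ≡⟨ double B π ⟩
      4 + Q * π                             ≤⟨ +-monoʳ-≤ 4 (*-monoʳ-≤ Q (primeCount≤good+primeDivisors N X)) ⟩
      4 + Q * (good + ω)                    ≡⟨ regroup Q good ω ⟩
      (4 + Q * ω) + Q * good                ≤⟨ +-monoˡ-≤ (Q * good) (+-monoʳ-≤ 4 (*-monoʳ-≤ Q ω≤4d²)) ⟩
      (4 + Q * (4 * (d * d))) + Q * good    ≤⟨ +-monoˡ-≤ (Q * good) 4+Q*4d²≤X ⟩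
      X + Q * good                          ∎)
      where
      open ≤-Reasoning
      π = primeCount X
      double : ∀ B π → (2 + B * π) + (2 + B * π) ≡ 4 + 2 * B * π
      double = solve-∀
      regroup : ∀ Q g ω → 4 + Q * (g + ω) ≡ (4 + Q * ω) + Q * g
      regroup = solve-∀

    Q*5d²≤k∸d : Q * (5 * (d * d)) ≤ k ∸ d
    Q*5d²≤k∸d = m+n≤o⇒m≤o∸n (Q * (5 * (d * d))) (begin
      Q * (5 * (d * d)) + d           ≡⟨ cong (_+ d) (expand b d) ⟩
      10000 * b * d ^ 3 + d           ≤⟨ +-monoʳ-≤ (10000 * b * d ^ 3) d≤d³ ⟩
      10000 * b * d ^ 3 + d ^ 3       ≡⟨ +-comm (10000 * b * d ^ 3) (d ^ 3) ⟩
      suc (10000 * b) * d ^ 3         ≤⟨ *-monoˡ-≤ (d ^ 3) 10000b<d ⟩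
      d ^ 4                           ∎)
      where
      open ≤-Reasoning
      expand : ∀ b d → 2 * (b * (1000 * d)) * (5 * (d * d)) ≡ 10000 * b * (d * (d * (d * 1)))
      expand = solve-∀
      d≤d³ : d ≤ d ^ 3
      d≤d³ = m≤m*n d (d ^ 2) {{m^n≢0 d 2}}

    [1+k]^d*N≤2^[5d²] : suc k ^ d * N ≤ 2 ^ (5 * (d * d))
    [1+k]^d*N≤2^[5d²] = begin
      suc k ^ d * N                               ≤⟨ *-mono-≤ (^-monoˡ-≤ d 1+k≤2^[1+4b]) (<⇒≤ N<2^[1+4d²]) ⟩
      (2 ^ suc (b * 4)) ^ d * 2 ^ suc (4 * (d * d)) ≡⟨ cong (_* 2 ^ suc (4 * (d * d))) (^-*-assoc 2 (suc (b * 4)) d) ⟩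
      2 ^ (suc (b * 4) * d) * 2 ^ suc (4 * (d * d)) ≡⟨ sym (^-distribˡ-+-* 2 (suc (b * 4) * d) _) ⟩
      2 ^ (suc (b * 4) * d + suc (4 * (d * d)))   ≤⟨ ^-monoʳ-≤ 2 exponent≤ ⟩
      2 ^ (5 * (d * d))                           ∎
      where
      open ≤-Reasoning
      1+k≤2^[1+4b] : suc k ≤ 2 ^ suc (b * 4)
      1+k≤2^[1+4b] = begin
        suc (d ^ 4)                   ≤⟨ +-monoˡ-≤ (d ^ 4) (m^n>0 d 4) ⟩
        d ^ 4 + d ^ 4                 ≤⟨ +-mono-≤ d^4≤2^[4b] d^4≤2^[4b] ⟩
        2 ^ (b * 4) + 2 ^ (b * 4)     ≡⟨ cong (2 ^ (b * 4) +_) (sym (+-identityʳ _)) ⟩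
        2 ^ suc (b * 4)               ∎
        where
        d^4≤2^[4b] : d ^ 4 ≤ 2 ^ (b * 4)
        d^4≤2^[4b] = ≤-trans (^-monoˡ-≤ 4 d≤2^b) (≤-reflexive (^-*-assoc 2 b 4))
      exponent≤ : suc (b * 4) * d + suc (4 * (d * d)) ≤ 5 * (d * d)
      exponent≤ = begin
        suc (b * 4) * d + suc (4 * (d * d))   ≡⟨ shift b d ⟩
        suc (b * 4) * d + 1 + 4 * (d * d)     ≤⟨ +-monoˡ-≤ (4 * (d * d)) (+-monoʳ-≤ (suc (b * 4) * d) 0<d) ⟩
        suc (b * 4) * d + d + 4 * (d * d)     ≡⟨ cong (_+ 4 * (d * d)) (collect b d) ⟩
        (2 + b * 4) * d + 4 * (d * d)         ≤⟨ +-monoˡ-≤ (4 * (d * d)) (*-monoˡ-≤ d 2+4b≤d) ⟩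
        d * d + 4 * (d * d)                   ≡⟨ cong (_+ 4 * (d * d)) (sym (*-identityˡ (d * d))) ⟩
        1 * (d * d) + 4 * (d * d)             ≡⟨ sym (*-distribʳ-+ (d * d) 1 4) ⟩
        5 * (d * d)                           ∎
        where
        shift : ∀ b d → suc (b * 4) * d + suc (4 * (d * d)) ≡ suc (b * 4) * d + 1 + 4 * (d * d)
        shift = solve-∀
        collect : ∀ b d → suc (b * 4) * d + d ≡ (2 + b * 4) * d
        collect = solve-∀

  badCount*N≤X^k : badCount N d (d ^ (1000 * d)) (d ^ 4) * N ≤ (d ^ (1000 * d)) ^ (d ^ 4)
  badCount*N≤X^k = begin
    badCount N d X k * N                              ≤⟨ *-monoˡ-≤ N (fewHits≤ 0<len k d) ⟩
    suc k ^ d * len ^ d * bad ^ (k ∸ d) * N           ≡⟨ cong (λ n → suc k ^ d * n ^ d * bad ^ (k ∸ d) * N) len≡X ⟩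
    suc k ^ d * X ^ d * bad ^ (k ∸ d) * N             ≡⟨ rearrange (suc k ^ d) (X ^ d) (bad ^ (k ∸ d)) N ⟩
    X ^ d * (bad ^ (k ∸ d) * (suc k ^ d * N))         ≤⟨ *-monoʳ-≤ (X ^ d) (*-monoʳ-≤ (bad ^ (k ∸ d)) [1+k]^d*N≤2^[5d²]) ⟩
    X ^ d * (bad ^ (k ∸ d) * 2 ^ (5 * (d * d)))       ≤⟨ *-monoʳ-≤ (X ^ d) (y^k*2^s≤x^k good+bad≡X X≤Q*good 0<Q Q*5d²≤k∸d) ⟩
    X ^ d * X ^ (k ∸ d)                               ≡⟨ sym (^-distribˡ-+-* X d (k ∸ d)) ⟩
    X ^ (d + (k ∸ d))                                 ≡⟨ cong (X ^_) (m+[n∸m]≡n d≤k) ⟩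
    X ^ k                                             ∎
    where
    open ≤-Reasoning
    0<len : 0 < len
    0<len = subst (0 <_) (sym len≡X) (m^n>0 d (1000 * d))
    0<Q : 0 < Q
    0<Q = *-mono-≤ {1} {2} (s≤s z≤n) (*-mono-≤ 0<b (*-mono-≤ {1} {1000} (s≤s z≤n) 0<d))
    d≤k : d ≤ k
    d≤k = m≤m*n d (d ^ 3) {{m^n≢0 d 3}}
    rearrange : ∀ a x y n → a * x * y * n ≡ x * (y * (a * n))
    rearrange = solve-∀

d₀<d : ∀ {d₀ N d} → 2 ^ suc (4 * (d₀ * d₀)) ≤ N → N < 2 ^ suc (4 * (d * d)) → d₀ < d
d₀<d N₀≤N N<2^[1+4d²] = ≰⇒> λ d≤d₀ → <⇒≱ N<2^[1+4d²] (≤-trans (^-monoʳ-≤ 2 (s≤s (*-monoʳ-≤ 4 (*-mono-≤ d≤d₀ d≤d₀)))) N₀≤N)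

-- Opaque so that the threshold 2 ^ (1 + 4 d₀²) is never normalised during type checking.
opaque
  d₀ : ℕ
  d₀ = 2 ^ 18

  d₀≡2^18 : d₀ ≡ 2 ^ 18
  d₀≡2^18 = refl

badCount*N≤X^k-for-large-d : ∀ {N d} → 0 < N → N < 2 ^ suc (4 * (d * d)) → 2 ^ 18 < d →
                             badCount N d (d ^ (1000 * d)) (d ^ 4) * N ≤ (d ^ (1000 * d)) ^ (d ^ 4)
badCount*N≤X^k-for-large-d 0<N N<2^[1+4d²] 2^18<d with ∃log-scale 2^18<d
... | b , 0<b , d≤2^b , 10000b<d = badCount*N≤X^k 0<N N<2^[1+4d²] 0<b d≤2^b 10000b<d

-- Only the half N ≤ e^(d²) of IsD N d is needed: together with N ≥ N₀ it already forces d > d₀.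
lemma4p3 : ∃₂ λ (C N₀ : ℕ) → ∀ N d → N₀ ≤ N → IsD N d →
             badCount N d (d ^ (1000 * d)) (d ^ 4) * N ≤ C * (d ^ (1000 * d)) ^ (d ^ 4)
lemma4p3 = 1 , 2 ^ suc (4 * (d₀ * d₀)) , bound
  where
  bound : ∀ N d → 2 ^ suc (4 * (d₀ * d₀)) ≤ N → IsD N d →
          badCount N d (d ^ (1000 * d)) (d ^ 4) * N ≤ 1 * (d ^ (1000 * d)) ^ (d ^ 4)
  bound N d N₀≤N (N≤e^[d²] , _) =
    ≤-trans (badCount*N≤X^k-for-large-d 0<N N<2^[1+4d²] (subst (_< d) d₀≡2^18 (d₀<d N₀≤N N<2^[1+4d²])))
            (≤-reflexive (sym (*-identityˡ ((d ^ (1000 * d)) ^ (d ^ 4)))))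
    where
    N<2^[1+4d²] : N < 2 ^ suc (4 * (d * d))
    N<2^[1+4d²] = expGt⇒< N≤e^[d²]
    0<N : 0 < N
    0<N = <-≤-trans (m^n>0 2 (suc (4 * (d₀ * d₀)))) N₀≤N
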